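{- Let $\mathbf Y$ be a countable $\mathcal L$-structure with $\mathrm{Age}(\mathbf Y)\subseteq\mathcal K$, let $<_{\mathbf Y}$ be a linear order of $\mathbf Y$ of order type $\omega$, and let $\eta:\mathbf Y\to\mathbf K$ be an embedding, increasing from $<_{\mathbf Y}$ to $<$, such that whenever $y\in\mathbf Y$, $m<\eta(y)$ and $R(m,\eta(y))\neq0$, then $m\in\mathrm{ran}(\eta)$. Suppose $n=\eta(y)$ for some $y\in\mathbf Y$, and let $y_0<_{\mathbf Y}y_1$ be $<_{\mathbf Y}$-consecutive elements of $\mathbf Y$ with $y_1\le_{\mathbf Y}y$. Then $c(n)|_{\eta(y_1)}=\mathrm{Left}\big(c(n)|_{\eta(y_0)+1},\eta(y_1)\big)$.
   Context: $\mathcal L=\{U_0,\dots,U_{k-1};R_0,\dots,R_{k-1}\}$ is a finite relational language, $U_i$ unary, $R_i$ binary, and all $\mathcal L$-structures $\mathbf A$ satisfy: every $R_i^{\mathbf A}$ is irreflexive; $\mathbf A=\bigsqcup_{i<k}U_i^{\mathbf A}$; $\mathbf A^2\setminus\{(a,a):a\in\mathbf A\}=\bigsqcup_{i<k}R_i^{\mathbf A}$; and there is $\mathrm{Flip}:k\to k$ with $\mathrm{Flip}^2=\mathrm{id}$, $\mathrm{Flip}(0)=0$, such that $R^{\mathbf A}(a,b)=i$ iff $R^{\mathbf A}(b,a)=\mathrm{Flip}(i)$, where $R^{\mathbf A}(a,b)=i$ means $R_i^{\mathbf A}(a,b)$. $\mathcal F$ is a finite set of finite irreducible $\mathcal L$-structures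 (i.e. $R^{\mathbf F}(a,b)\ne0$ for all $a\neq b$) and $\mathcal K=\mathrm{Forb}(\mathcal F)$ is the class of finite $\mathcal L$-structures into which no member of $\mathcal F$ embeds. $\mathbf K$ is a Fraïssé limit of $\mathcal K$ with underlying set $\omega$ (assumed left dense), and $R=R^{\mathbf K}$. $T=k^{<\omega}$; for $j<\omega$ the coding node $c(j)\in k^j$ is given by $c(j)(i)=R(i,j)$ for $i<j$; $s|_n$ is the restriction of $s$ to length $n$; $\mathrm{Left}(s,n)$ is the extension of $s$ to length $n\ge\ell(s)$ by appending zeros. -}

module Defs where

open import Data.Nat using (ℕ; zero; suc; _<_; _∸_)
open import Data.Fin using (Fin)
open import Data.List using (List; map; upTo; take; _++_; replicate; length)
open import Data.List.Relation.Unary.All using (All)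
open import Data.Product using (Σ; _×_; _,_; proj₂)
open import Relation.Binary.PropositionalEquality using (_≡_; _≢_)
open import Relation.Nullary using (¬_)
open import Function.Definitions using (Injective; Bijective)

-- The language L = {U_0..U_{k-1}; R_0..R_{k-1}} with k = suc k₀,
-- together with the involution Flip : k → k fixing 0.
record Lang : Set where
  field
    k₀         : ℕ
    Flip       : Fin (suc k₀) → Fin (suc k₀)
    Flip-invol : ∀ i → Flip (Flip i) ≡ i
    Flip-zero  : Flip Fin.zero ≡ Fin.zero

module _ (L : Lang) where
  open Lang L

  Col : Set
  Col = Fin (suc k₀)

  -- An L-structure on carrier A. U a = i means U_i(a); R a b = i means
  -- R_i(a,b) for a ≠ b. The diagonal carries no relation; by convention
  -- R a a is fixed to 0 (no information).
  record Str (A : Set) : Set where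
    field
      U      : A → Col
      R      : A → A → Col
      R-diag : ∀ a → R a a ≡ Fin.zero
      R-flip : ∀ a b → R b a ≡ Flip (R a b)

  record IsEmbedding {A B : Set} (SA : Str A) (SB : Str B) (f : A → B) : Set where
    field
      inj   : Injective _≡_ _≡_ f
      U-pres : ∀ a → Str.U SB (f a) ≡ Str.U SA a
      R-pres : ∀ a b → Str.R SB (f a) (f b) ≡ Str.R SA a b

  Embeds : {A B : Set} → Str A → Str B → Set
  Embeds {A} {B} SA SB = Σ (A → B) (IsEmbedding SA SB)

  FinStr : Set
  FinStr = Σ ℕ (λ n → Str (Fin n))

  Irreducible : {n : ℕ} → Str (Fin n) → Set
  Irreducible S = ∀ a b → a ≢ b → Str.R S a b ≢ Fin.zero

  Forb : List FinStr → {n : ℕ} → Str (Fin n) → Set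
  Forb 𝓕 B = All (λ F → ¬ Embeds (proj₂ F) B) 𝓕

  AgeSubForb : {A : Set} → Str A → List FinStr → Set
  AgeSubForb Y 𝓕 = ∀ n (B : Str (Fin n)) → Embeds B Y → Forb 𝓕 B

  Ultrahomogeneous : Str ℕ → Set
  Ultrahomogeneous K =
    ∀ n (f g : Fin n → ℕ) → Injective _≡_ _≡_ f → Injective _≡_ _≡_ g →
    (∀ i → Str.U K (f i) ≡ Str.U K (g i)) →
    (∀ i j → Str.R K (f i) (f j) ≡ Str.R K (g i) (g j)) →
    Σ (ℕ → ℕ) (λ σ → Bijective _≡_ _≡_ σ × IsEmbedding K K σ × (∀ i → σ (f i) ≡ g i))

  IsFraisseLimit : List FinStr → Str ℕ → Set
  IsFraisseLimit 𝓕 K =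
    (∀ n (B : Str (Fin n)) → Embeds B K → Forb 𝓕 B) ×
    (∀ n (B : Str (Fin n)) → Forb 𝓕 B → Embeds B K) ×
    Ultrahomogeneous K

  -- nodes of T = k^{<ω} are lists; coding node c(j) ∈ k^j, c(j)(i) = R(i,j)
  codingNode : Str ℕ → ℕ → List Col
  codingNode K j = map (λ i → Str.R K i j) (upTo j)

  restrict : List Col → ℕ → List Col
  restrict s n = take n s

  Left : List Col → ℕ → List Col
  Left s n = s ++ replicate (n ∸ length s) Fin.zero

OrderTypeω : {A : Set} → (A → A → Set) → Set
OrderTypeω {A} _<Y_ =
  Σ (ℕ → A) (λ e → Bijective _≡_ _≡_ e × (∀ i j → i < j → e i <Y e j) × (∀ i j → e i <Y e j → i < j))

Consecutive : {A : Set} → (A → A → Set) → A → A → Set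
Consecutive {A} _<Y_ y0 y1 = y0 <Y y1 × ¬ (Σ A (λ z → y0 <Y z × z <Y y1))

module Submission where

-- Proposition 5.4: between two <_Y-consecutive points y₀ <_Y y₁ lying below y,
-- the coding node c(η y) carries only the colour 0 strictly between the levels
-- η y₀ and η y₁, so c(η y)|_{η y₁} is obtained from c(η y)|_{η y₀ + 1} by padding
-- with zeros.

open import Defs
open import Data.Nat using (ℕ; zero; suc; _<_; _≤_; _∸_; z≤n; s≤s)
open import Data.Nat.Properties using (<-irrefl; <-asym; <-cmp; <⇒≤; ≤-refl; <-≤-trans)
open import Data.Fin using (Fin; _≟_)
open import Data.List using (List; _∷_; take; applyUpTo; replicate; _++_)
open import Data.List.Properties using (map-upTo; length-applyUpTo)
open import Data.List.Relation.Unary.All using (All)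
open import Data.Product using (Σ; proj₂; _,_)
open import Data.Sum using (_⊎_; inj₁; inj₂)
open import Data.Empty using (⊥-elim)
open import Relation.Nullary using (yes; no)
open import Relation.Binary using (tri<; tri≈; tri>)
open import Relation.Binary.PropositionalEquality
  using (_≡_; _≢_; refl; cong; cong₂; sym; module ≡-Reasoning)
open import Function using (_∘_)

take-applyUpTo : {X : Set} (f : ℕ → X) {b n : ℕ} → b ≤ n →
                 take b (applyUpTo f n) ≡ applyUpTo f b
take-applyUpTo f {zero}          _         = refl
take-applyUpTo f {suc b} {suc n} (s≤s b≤n) = cong (f 0 ∷_) (take-applyUpTo (f ∘ suc) b≤n)

applyUpTo-const : {X : Set} {z : X} (f : ℕ → X) (b : ℕ) →
                  (∀ m → m < b → f m ≡ z) → applyUpTo f b ≡ replicate b z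
applyUpTo-const f zero    _     = refl
applyUpTo-const f (suc b) const =
  cong₂ _∷_ (const 0 (s≤s z≤n)) (applyUpTo-const (f ∘ suc) b (λ m m<b → const (suc m) (s≤s m<b)))

applyUpTo-gap : {X : Set} {z : X} (f : ℕ → X) {a b : ℕ} → a < b →
                (∀ m → a < m → m < b → f m ≡ z) →
                applyUpTo f b ≡ applyUpTo f (suc a) ++ replicate (b ∸ suc a) z
applyUpTo-gap f {zero} {suc b} _ gap =
  cong (f 0 ∷_) (applyUpTo-const (f ∘ suc) b (λ m m<b → gap (suc m) (s≤s z≤n) (s≤s m<b)))
applyUpTo-gap f {suc a} {suc b} (s≤s a<b) gap =
  cong (f 0 ∷_) (applyUpTo-gap (f ∘ suc) a<b (λ m a<m m<b → gap (suc m) (s≤s a<m) (s≤s m<b)))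

module CodingNodes (L : Lang) (K : Str L ℕ) where
  open Str K using (R)

  restrict-codingNode : {b n : ℕ} → b ≤ n →
                        restrict L (codingNode L K n) b ≡ applyUpTo (λ i → R i n) b
  restrict-codingNode {b} {n} b≤n = begin
    restrict L (codingNode L K n) b     ≡⟨ cong (take b) (map-upTo (λ i → R i n) n) ⟩
    take b (applyUpTo (λ i → R i n) n)  ≡⟨ take-applyUpTo (λ i → R i n) b≤n ⟩
    applyUpTo (λ i → R i n) b           ∎
    where open ≡-Reasoning

  codingNode-left : {a b n : ℕ} → a < b → b ≤ n →
                    (∀ m → a < m → m < b → R m n ≡ Fin.zero) →
                    restrict L (codingNode L K n) b
                      ≡ Left L (restrict L (codingNode L K n) (suc a)) b
  codingNode-left {a} {b} {n} a<b b≤n gap = begin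
    restrict L (codingNode L K n) b
      ≡⟨ restrict-codingNode b≤n ⟩
    applyUpTo f b
      ≡⟨ applyUpTo-gap f a<b gap ⟩
    applyUpTo f (suc a) ++ replicate (b ∸ suc a) Fin.zero
      ≡⟨ cong (λ l → applyUpTo f (suc a) ++ replicate (b ∸ l) Fin.zero)
              (sym (length-applyUpTo f (suc a))) ⟩
    Left L (applyUpTo f (suc a)) b
      ≡⟨ cong (λ s → Left L s b) (sym (restrict-codingNode (<-≤-trans a<b b≤n))) ⟩
    Left L (restrict L (codingNode L K n) (suc a)) b
      ∎
    where
    open ≡-Reasoning
    f : ℕ → Col L
    f i = R i n

-- A strictly increasing map η from an order of type ω into ℕ reflects the
-- order: comparing the ω-indices of u and v, the cases "equal" and "v first"
-- contradict η u < η v.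
reflects-order : {A : Set} (_<Y_ : A → A → Set) → OrderTypeω _<Y_ →
                 (η : A → ℕ) → (∀ a b → a <Y b → η a < η b) →
                 ∀ u v → η u < η v → u <Y v
reflects-order _<Y_ (e , (_ , e-onto) , e-mono , _) η η-mono u v ηu<ηv
  with e-onto u | e-onto v
... | i , ei≡u | j , ej≡v = compare (ei≡u refl) (ej≡v refl)
  where
  compare : e i ≡ u → e j ≡ v → u <Y v
  compare refl refl with <-cmp i j
  ... | tri< i<j _ _ = e-mono i j i<j
  ... | tri≈ _ refl _ = ⊥-elim (<-irrefl refl ηu<ηv)
  ... | tri> _ _ j<i = ⊥-elim (<-asym ηu<ηv (η-mono _ _ (e-mono j i j<i)))

-- The gap between consecutive points: if y₀ <_Y y₁ are consecutive and
-- η y₁ ≤ η y, then no m strictly between η y₀ and η y₁ has R(m, η y) ≠ 0,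
-- since by closure such an m would be η y′ for a y′ strictly between y₀ and y₁.
consecutive-gap : (L : Lang) (K : Str L ℕ) {A : Set} (_<Y_ : A → A → Set) →
                  OrderTypeω _<Y_ → (η : A → ℕ) → (∀ a b → a <Y b → η a < η b) →
                  (∀ y m → m < η y → Str.R K m (η y) ≢ Fin.zero → Σ A (λ y′ → η y′ ≡ m)) →
                  (y y₀ y₁ : A) → Consecutive _<Y_ y₀ y₁ → η y₁ ≤ η y →
                  ∀ m → η y₀ < m → m < η y₁ → Str.R K m (η y) ≡ Fin.zero
consecutive-gap L K _<Y_ ω η η-mono closed y y₀ y₁ (_ , nothing-between) ηy₁≤ηy m ηy₀<m m<ηy₁
  with Str.R K m (η y) ≟ Fin.zero
... | yes R≡0 = R≡0
... | no R≢0 with closed y m (<-≤-trans m<ηy₁ ηy₁≤ηy) R≢0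
... | y′ , refl =
  ⊥-elim (nothing-between (y′ , reflects-order _<Y_ ω η η-mono y₀ y′ ηy₀<m
                              , reflects-order _<Y_ ω η η-mono y′ y₁ m<ηy₁))

proposition5p4 : (L : Lang) (𝓕 : List (FinStr L)) →
    All (λ F → Irreducible L (proj₂ F)) 𝓕 →
    (K : Str L ℕ) → IsFraisseLimit L 𝓕 K →
    {A : Set} (Y : Str L A) → AgeSubForb L Y 𝓕 →
    (_<Y_ : A → A → Set) → OrderTypeω _<Y_ →
    (η : A → ℕ) → IsEmbedding L Y K η →
    (∀ a b → a <Y b → η a < η b) →
    (∀ y m → m < η y → Str.R K m (η y) ≢ Fin.zero → Σ A (λ y′ → η y′ ≡ m)) →
    (y y₀ y₁ : A) → Consecutive _<Y_ y₀ y₁ → (y₁ ≡ y ⊎ y₁ <Y y) →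
    restrict L (codingNode L K (η y)) (η y₁)
      ≡ Left L (restrict L (codingNode L K (η y)) (suc (η y₀))) (η y₁)
proposition5p4 L _ _ K _ _ _ _<Y_ ω η _ η-mono closed y y₀ y₁ consec@(y₀<y₁ , _) y₁≤y =
  CodingNodes.codingNode-left L K (η-mono y₀ y₁ y₀<y₁) ηy₁≤ηy
    (consecutive-gap L K _<Y_ ω η η-mono closed y y₀ y₁ consec ηy₁≤ηy)
  where
  η-mono-≤ : y₁ ≡ y ⊎ y₁ <Y y → η y₁ ≤ η y
  η-mono-≤ (inj₁ refl) = ≤-refl
  η-mono-≤ (inj₂ y₁<y) = <⇒≤ (η-mono y₁ y y₁<y)

  ηy₁≤ηy : η y₁ ≤ η y
  ηy₁≤ηy = η-mono-≤ y₁≤y
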